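{- Let $S$ be an affine counter system of dimension $n$ and $c=\delta_0\dots\delta_{k-1}$ a simple cycle of $S$ with $\delta_i=\langle q_i,\vec C_i\vec x\le\vec d_i,(\vec A_i,\vec b_i),q_{i+1}\rangle$, $q_k=q_0$. Let $f_c=(\vec A_c,\vec b_c)$ with $\vec A_c=\vec A_{k-1}\cdots\vec A_0$ and $\vec b_c=\sum_{i=0}^{k-1}\vec A_{k-1}\cdots\vec A_{i+1}\vec b_i$, and let $\alpha\ge0$, $\beta\ge1$ be integers with $\vec A_c^\alpha=\vec A_c^{\alpha+\beta}$. Define $\vec w_0=\vec A_c^\alpha\cdot f_c^\beta(\vec 0)$ and $\vec w_{i+1}=\vec A_i\cdot\vec w_i$ for $i\in[0,k-2]$, and call $c$ infinitely iterable iff $\vec C_i\cdot\vec w_i\le\vec 0$ for all $i\in[0,k-1]$. Given an infinite pseudo-execution $(q_0,\vec v_0)\overset{\tau_0}{\leadsto}(q_1,\vec v_1)\overset{\tau_1}{\leadsto}\cdots$ of $S$ iterating $c$ (i.e. $\tau_i=\delta_{i\bmod k}$), the sequence $(q_0,\vec v_0)\xrightarrow{\tau_0}(q_1,\vec v_1)\xrightarrow{\tau_1}\cdots$ is an infinite execution of $S$ if and only if $c$ is infinitely iterable and $\vec v_i$ satisfies the guard of $\tau_i$ for all $i\in[0,(\alpha+\beta+1)k-1]$.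
   Context: An affine counter system has transition rules $\delta=\langle q,g,f,q'\rangle$ with $g$ a guard (a finite conjunction of integer linear inequalities $\vec C\vec x\le\vec d$) and $f=(\vec A,\vec b)$ an affine update $f(\vec v)=\vec A\vec v+\vec b$; $f^j$ denotes $j$-fold composition. The relaxed relation is $(q,\vec v)\overset{\delta}{\leadsto}(q',\vec v')$ iff $q,q'$ are source and target of $\delta$ and $\vec v'=f(\vec v)$ (guards not tested); a pseudo-execution is a sequence of relaxed steps. An execution is a sequence of genuine steps, which additionally require $\vec v$ to satisfy the guard. Control state indices are taken modulo $k$. -}

module Defs where

open import Data.Nat as ℕ using (ℕ; zero; suc; NonZero)
open import Data.Nat.DivMod using (_mod_)
open import Data.Integer as ℤ using (ℤ; 0ℤ; 1ℤ)
open import Data.Fin using (Fin; toℕ; _≟_)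
open import Data.Vec using (Vec; map; zipWith; foldr; transpose; tabulate; lookup; replicate)
open import Data.List using (List)
open import Data.List.Membership.Propositional using (_∈_)
open import Data.Product using (_×_)
open import Function using (Injective)
open import Relation.Nullary using (does)
open import Data.Bool using (if_then_else_)
open import Relation.Binary.PropositionalEquality using (_≡_)

Vector : ℕ → Set
Vector n = Vec ℤ n

-- an m × n matrix is a vector of m rows of length n
Matrix : ℕ → ℕ → Set
Matrix m n = Vec (Vector n) m

dot : ∀ {n} → Vector n → Vector n → ℤ
dot u v = foldr (λ _ → ℤ) ℤ._+_ 0ℤ (zipWith ℤ._*_ u v)

_·ᵥ_ : ∀ {m n} → Matrix m n → Vector n → Vector m
M ·ᵥ v = map (λ row → dot row v) M

_·ₘ_ : ∀ {m n p} → Matrix m n → Matrix n p → Matrix m p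
M ·ₘ N = map (λ row → map (λ col → dot row col) (transpose N)) M

_+ᵥ_ : ∀ {n} → Vector n → Vector n → Vector n
_+ᵥ_ = zipWith ℤ._+_

𝟎 : ∀ {n} → Vector n
𝟎 = replicate _ 0ℤ

idM : ∀ {n} → Matrix n n
idM = tabulate (λ i → tabulate (λ j → if does (i ≟ j) then 1ℤ else 0ℤ))

_^ₘ_ : ∀ {n} → Matrix n n → ℕ → Matrix n n
M ^ₘ zero  = idM
M ^ₘ suc j = M ·ₘ (M ^ₘ j)

_≤ᵥ_ : ∀ {m} → Vector m → Vector m → Set
u ≤ᵥ v = ∀ j → lookup u j ℤ.≤ lookup v j

record Affine (n : ℕ) : Set where
  constructor ⟨_,_⟩
  field
    A : Matrix n n
    b : Vector n

apply : ∀ {n} → Affine n → Vector n → Vector n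
apply ⟨ A , b ⟩ v = (A ·ᵥ v) +ᵥ b

iterate : ∀ {n} → Affine n → ℕ → Vector n → Vector n
iterate f zero    v = v
iterate f (suc j) v = apply f (iterate f j v)

record Transition (Q : Set) (n : ℕ) : Set where
  field
    src  : Q
    rows : ℕ
    C    : Matrix rows n
    d    : Vector rows
    A    : Matrix n n
    b    : Vector n
    tgt  : Q

  update : Affine n
  update = ⟨ A , b ⟩

  Sat : Vector n → Set
  Sat v = (C ·ᵥ v) ≤ᵥ d

record ACS (n : ℕ) : Set₁ where
  field
    Q     : Set
    rules : List (Transition Q n)

module _ {n : ℕ} (S : ACS n) where
  open ACS S

  next : ∀ {k} .{{_ : NonZero k}} → Fin k → Fin k
  next {k} i = (suc (toℕ i)) mod k

  record SimpleCycle (k : ℕ) .{{_ : NonZero k}} (δ : Fin k → Transition Q n) : Set where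
    field
      inS       : ∀ i → δ i ∈ rules
      chained   : ∀ i → Transition.tgt (δ i) ≡ Transition.src (δ (next i))
      distinct  : Injective _≡_ _≡_ (λ i → Transition.src (δ i))

  RelaxedStep : Q → Vector n → Transition Q n → Q → Vector n → Set
  RelaxedStep q v δ q' v' =
    Transition.src δ ≡ q × Transition.tgt δ ≡ q' × v' ≡ apply (Transition.update δ) v

  Step : Q → Vector n → Transition Q n → Q → Vector n → Set
  Step q v δ q' v' = RelaxedStep q v δ q' v' × Transition.Sat δ v

  IsPseudoExecution : (ℕ → Q) → (ℕ → Vector n) → (ℕ → Transition Q n) → Set
  IsPseudoExecution q v τ =
    ∀ i → τ i ∈ rules × RelaxedStep (q i) (v i) (τ i) (q (suc i)) (v (suc i))

  IsExecution : (ℕ → Q) → (ℕ → Vector n) → (ℕ → Transition Q n) → Set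
  IsExecution q v τ =
    ∀ i → τ i ∈ rules × Step (q i) (v i) (τ i) (q (suc i)) (v (suc i))

module Cycle {Q : Set} {n k : ℕ} .{{_ : NonZero k}} (δ : Fin k → Transition Q n) where

  δℕ : ℕ → Transition Q n
  δℕ i = δ (i mod k)

  Aℕ : ℕ → Matrix n n
  Aℕ i = Transition.A (δℕ i)

  bℕ : ℕ → Vector n
  bℕ i = Transition.b (δℕ i)

  -- prodFrom i m = A_{i+m-1} ⋯ A_{i+1} A_i   (identity when m = 0)
  prodFrom : ℕ → ℕ → Matrix n n
  prodFrom i zero    = idM
  prodFrom i (suc m) = Aℕ (i ℕ.+ m) ·ₘ prodFrom i m

  Ac : Matrix n n
  Ac = prodFrom 0 k

  -- Σ_{i<m} A_{k-1} ⋯ A_{i+1} b_i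
  bsum : ℕ → Vector n
  bsum zero    = 𝟎
  bsum (suc i) = bsum i +ᵥ (prodFrom (suc i) (k ℕ.∸ suc i) ·ᵥ bℕ i)

  bc : Vector n
  bc = bsum k

  fc : Affine n
  fc = ⟨ Ac , bc ⟩

  module _ (α β : ℕ) where
    w : ℕ → Vector n
    w zero    = (Ac ^ₘ α) ·ᵥ iterate fc β 𝟎
    w (suc i) = Aℕ i ·ᵥ w i

    InfinitelyIterable : Set
    InfinitelyIterable = ∀ (i : Fin k) → (Transition.C (δ i) ·ᵥ w (toℕ i)) ≤ᵥ 𝟎

-- Along a pseudo-execution iterating the cycle, the state after m full turns is f_c^m(v₀).
-- Because A_c^α = A_c^(α+β), skipping β more turns past turn α only adds the vector
-- w₀ = A_c^α f_c^β(0), and each position j inside the cycle sees its transport w_j. Hence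
-- the state at position (α + tβ)k + j is v_{αk+j} + t·w_j: from turn α on, every position
-- moves along a ray. A guard C v ≤ d holds along a whole ray v + t·w iff it holds at its origin
-- and C w ≤ 0, and w is k-periodic because A_c fixes w₀; so guards everywhere amount to
-- infinite iterability plus guards on the first (α + β)k positions.
module Submission where

open import Defs
open import Algebra.Bundles using (AbelianGroup)
open import Data.Bool using (if_then_else_)
open import Data.Empty using (⊥-elim)
open import Data.Fin as Fin using (Fin; toℕ; _≟_)
open import Data.Fin.Properties using (toℕ-fromℕ<; toℕ-injective; toℕ<n; fromℕ<-cong)
open import Data.Integer as ℤ using (ℤ; 0ℤ; 1ℤ; +_; -[1+_]; ∣_∣)
import Data.Integer.Properties as ℤP
open import Data.Integer.Tactic.RingSolver using (solve-∀)
open import Data.Nat using (ℕ; zero; suc; NonZero; >-nonZero; _+_; _*_; _∸_; _%_; _/_; _<_; _≤_)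
import Data.Nat.Properties as ℕP
open import Data.Nat.DivMod using (_mod_; m≡m%n+[m/n]*n; m%n<n; m<n⇒m%n≡m; [m+n]%n≡m%n; [m+kn]%n≡m%n)
import Data.Nat.Tactic.RingSolver as ℕ-Solver
open import Data.Product using (_×_; ∃-syntax; _,_; proj₁; proj₂)
open import Data.Vec using (Vec; []; _∷_; map; replicate; tabulate; lookup; transpose; _⊛_; head; tail)
open import Data.Vec.Properties
  using (zipWith-assoc; zipWith-comm; zipWith-identityˡ; zipWith-identityʳ; lookup-zipWith;
         lookup-replicate; map-replicate; tabulate-cong; tabulate∘lookup; tabulate-∘)
open import Function.Bundles using (_⇔_; mk⇔; Equivalence)
open import Relation.Nullary using (does; yes; no)
open import Relation.Binary.PropositionalEquality
  using (_≡_; refl; sym; trans; cong; cong₂; subst; subst₂; module ≡-Reasoning)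

open import Algebra.Properties.Group (AbelianGroup.group ℤP.+-0-abelianGroup) using (∙-cancelʳ)

+ᵥ-assoc : ∀ {n} (x y z : Vector n) → (x +ᵥ y) +ᵥ z ≡ x +ᵥ (y +ᵥ z)
+ᵥ-assoc = zipWith-assoc ℤP.+-assoc

+ᵥ-comm : ∀ {n} (x y : Vector n) → x +ᵥ y ≡ y +ᵥ x
+ᵥ-comm = zipWith-comm ℤP.+-comm

+ᵥ-identityˡ : ∀ {n} (x : Vector n) → 𝟎 +ᵥ x ≡ x
+ᵥ-identityˡ = zipWith-identityˡ ℤP.+-identityˡ

+ᵥ-identityʳ : ∀ {n} (x : Vector n) → x +ᵥ 𝟎 ≡ x
+ᵥ-identityʳ = zipWith-identityʳ ℤP.+-identityʳ

+ᵥ-cancelʳ : ∀ {n} (x y z : Vector n) → x +ᵥ z ≡ y +ᵥ z → x ≡ y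
+ᵥ-cancelʳ []      []      []      _  = refl
+ᵥ-cancelʳ (a ∷ x) (b ∷ y) (c ∷ z) eq =
  cong₂ _∷_ (∙-cancelʳ c a b (cong head eq)) (+ᵥ-cancelʳ x y z (cong tail eq))

_*ᵥ_ : ∀ {n} → ℕ → Vector n → Vector n
zero  *ᵥ x = 𝟎
suc t *ᵥ x = (t *ᵥ x) +ᵥ x

lookup-*ᵥ : ∀ {n} t (x : Vector n) j → lookup (t *ᵥ x) j ≡ + t ℤ.* lookup x j
lookup-*ᵥ zero    x j = trans (lookup-replicate j 0ℤ) (sym (ℤP.*-zeroˡ (lookup x j)))
lookup-*ᵥ (suc t) x j = begin
  lookup ((t *ᵥ x) +ᵥ x) j           ≡⟨ lookup-zipWith ℤ._+_ j (t *ᵥ x) x ⟩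
  lookup (t *ᵥ x) j ℤ.+ lookup x j   ≡⟨ cong (ℤ._+ lookup x j) (lookup-*ᵥ t x j) ⟩
  + t ℤ.* lookup x j ℤ.+ lookup x j  ≡⟨ distrib (+ t) (lookup x j) ⟩
  (1ℤ ℤ.+ + t) ℤ.* lookup x j        ≡⟨ cong (ℤ._* lookup x j) (sym (ℤP.pos-+ 1 t)) ⟩
  + suc t ℤ.* lookup x j             ∎
  where
  open ≡-Reasoning
  distrib : ∀ a b → a ℤ.* b ℤ.+ b ≡ (1ℤ ℤ.+ a) ℤ.* b
  distrib = solve-∀

dot-distribˡ-+ᵥ : ∀ {n} (u x y : Vector n) → dot u (x +ᵥ y) ≡ dot u x ℤ.+ dot u y
dot-distribˡ-+ᵥ []      []      []      = refl
dot-distribˡ-+ᵥ (a ∷ u) (b ∷ x) (c ∷ y) =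
  trans (cong (ℤ._+_ (a ℤ.* (b ℤ.+ c))) (dot-distribˡ-+ᵥ u x y)) (shuffle a b c _ _)
  where
  shuffle : ∀ a b c p q → a ℤ.* (b ℤ.+ c) ℤ.+ (p ℤ.+ q) ≡ (a ℤ.* b ℤ.+ p) ℤ.+ (a ℤ.* c ℤ.+ q)
  shuffle = solve-∀

dot-distribʳ-+ᵥ : ∀ {n} (x y u : Vector n) → dot (x +ᵥ y) u ≡ dot x u ℤ.+ dot y u
dot-distribʳ-+ᵥ []      []      []      = refl
dot-distribʳ-+ᵥ (b ∷ x) (c ∷ y) (a ∷ u) =
  trans (cong (ℤ._+_ ((b ℤ.+ c) ℤ.* a)) (dot-distribʳ-+ᵥ x y u)) (shuffle a b c _ _)
  where
  shuffle : ∀ a b c p q → (b ℤ.+ c) ℤ.* a ℤ.+ (p ℤ.+ q) ≡ (b ℤ.* a ℤ.+ p) ℤ.+ (c ℤ.* a ℤ.+ q)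
  shuffle = solve-∀

dot-zeroˡ : ∀ {n} (u : Vector n) → dot 𝟎 u ≡ 0ℤ
dot-zeroˡ []      = refl
dot-zeroˡ (a ∷ u) = cong (ℤ._+_ 0ℤ) (dot-zeroˡ u)

dot-zeroʳ : ∀ {n} (u : Vector n) → dot u 𝟎 ≡ 0ℤ
dot-zeroʳ []      = refl
dot-zeroʳ (a ∷ u) = cong₂ ℤ._+_ (ℤP.*-zeroʳ a) (dot-zeroʳ u)

dot-scaleˡ : ∀ {n} a (u x : Vector n) → dot (map (a ℤ.*_) u) x ≡ a ℤ.* dot u x
dot-scaleˡ a []      []      = sym (ℤP.*-zeroʳ a)
dot-scaleˡ a (b ∷ u) (c ∷ x) =
  trans (cong (ℤ._+_ ((a ℤ.* b) ℤ.* c)) (dot-scaleˡ a u x)) (factor a b c _)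
  where
  factor : ∀ a b c p → (a ℤ.* b) ℤ.* c ℤ.+ a ℤ.* p ≡ a ℤ.* (b ℤ.* c ℤ.+ p)
  factor = solve-∀

·ᵥ-distrib-+ᵥ : ∀ {m n} (M : Matrix m n) (x y : Vector n) → M ·ᵥ (x +ᵥ y) ≡ (M ·ᵥ x) +ᵥ (M ·ᵥ y)
·ᵥ-distrib-+ᵥ []      x y = refl
·ᵥ-distrib-+ᵥ (r ∷ M) x y = cong₂ _∷_ (dot-distribˡ-+ᵥ r x y) (·ᵥ-distrib-+ᵥ M x y)

·ᵥ-zeroʳ : ∀ {m n} (M : Matrix m n) → M ·ᵥ 𝟎 ≡ 𝟎
·ᵥ-zeroʳ []      = refl
·ᵥ-zeroʳ (r ∷ M) = cong₂ _∷_ (dot-zeroʳ r) (·ᵥ-zeroʳ M)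

·ᵥ-*ᵥ : ∀ {m n} (M : Matrix m n) t (x : Vector n) → M ·ᵥ (t *ᵥ x) ≡ t *ᵥ (M ·ᵥ x)
·ᵥ-*ᵥ M zero    x = ·ᵥ-zeroʳ M
·ᵥ-*ᵥ M (suc t) x = trans (·ᵥ-distrib-+ᵥ M (t *ᵥ x) x) (cong (_+ᵥ (M ·ᵥ x)) (·ᵥ-*ᵥ M t x))

dot-transpose : ∀ {m p} (r : Vector m) (N : Matrix m p) (x : Vector p) →
                dot (map (dot r) (transpose N)) x ≡ dot r (N ·ᵥ x)
dot-transpose {p = p} [] [] x = trans (cong (λ z → dot z x) (map-replicate (dot []) [] p)) (dot-zeroˡ x)
dot-transpose {suc m} (a ∷ r) (row ∷ N) x = begin
  dot (map (dot (a ∷ r)) (transpose (row ∷ N))) x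
    ≡⟨ cong (λ z → dot z x) (columns row (transpose N)) ⟩
  dot (map (a ℤ.*_) row +ᵥ map (dot r) (transpose N)) x
    ≡⟨ dot-distribʳ-+ᵥ (map (a ℤ.*_) row) _ x ⟩
  dot (map (a ℤ.*_) row) x ℤ.+ dot (map (dot r) (transpose N)) x
    ≡⟨ cong₂ ℤ._+_ (dot-scaleˡ a row x) (dot-transpose r N x) ⟩
  a ℤ.* dot row x ℤ.+ dot r (N ·ᵥ x) ∎
  where
  open ≡-Reasoning
  columns : ∀ {p} (row : Vector p) (T : Vec (Vector m) p) →
            map (dot (a ∷ r)) ((replicate p _∷_ ⊛ row) ⊛ T) ≡ map (a ℤ.*_) row +ᵥ map (dot r) T
  columns []        []      = refl
  columns (x ∷ row) (t ∷ T) = cong (_ ∷_) (columns row T)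

·ₘ-·ᵥ-assoc : ∀ {m n p} (M : Matrix m n) (N : Matrix n p) (x : Vector p) →
              (M ·ₘ N) ·ᵥ x ≡ M ·ᵥ (N ·ᵥ x)
·ₘ-·ᵥ-assoc []      N x = refl
·ₘ-·ᵥ-assoc (r ∷ M) N x = cong₂ _∷_ (dot-transpose r N x) (·ₘ-·ᵥ-assoc M N x)

idM-·ᵥ : ∀ {n} (x : Vector n) → idM ·ᵥ x ≡ x
idM-·ᵥ x = trans (sym (tabulate-∘ (λ row → dot row x) unitRow))
                 (trans (tabulate-cong (λ i → dot-unitRow i x)) (tabulate∘lookup x))
  where
  unitRow : ∀ {n} → Fin n → Vector n
  unitRow i = tabulate (λ j → if does (i ≟ j) then 1ℤ else 0ℤ)
  zeros : ∀ {n} → tabulate {n = n} (λ _ → 0ℤ) ≡ 𝟎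
  zeros {zero}  = refl
  zeros {suc n} = cong (0ℤ ∷_) zeros
  dot-unitRow : ∀ {n} (i : Fin n) (x : Vector n) → dot (unitRow i) x ≡ lookup x i
  dot-unitRow Fin.zero    (a ∷ x) =
    trans (cong₂ ℤ._+_ (ℤP.*-identityˡ a) (trans (cong (λ z → dot z x) zeros) (dot-zeroˡ x)))
          (ℤP.+-identityʳ a)
  dot-unitRow (Fin.suc i) (a ∷ x) = trans (cong (ℤ._+_ (0ℤ ℤ.* a)) (dot-unitRow i x)) (ℤP.+-identityˡ _)

^ₘ-+-·ᵥ : ∀ {n} (A : Matrix n n) a b (x : Vector n) →
          (A ^ₘ (a + b)) ·ᵥ x ≡ (A ^ₘ a) ·ᵥ ((A ^ₘ b) ·ᵥ x)
^ₘ-+-·ᵥ A zero    b x = sym (idM-·ᵥ _)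
^ₘ-+-·ᵥ A (suc a) b x = begin
  (A ·ₘ (A ^ₘ (a + b))) ·ᵥ x          ≡⟨ ·ₘ-·ᵥ-assoc A _ x ⟩
  A ·ᵥ ((A ^ₘ (a + b)) ·ᵥ x)          ≡⟨ cong (A ·ᵥ_) (^ₘ-+-·ᵥ A a b x) ⟩
  A ·ᵥ ((A ^ₘ a) ·ᵥ ((A ^ₘ b) ·ᵥ x))  ≡⟨ ·ₘ-·ᵥ-assoc A _ _ ⟨
  (A ·ₘ (A ^ₘ a)) ·ᵥ ((A ^ₘ b) ·ᵥ x)  ∎
  where open ≡-Reasoning

·ᵥ-^ₘ-comm : ∀ {n} (A : Matrix n n) a (x : Vector n) → A ·ᵥ ((A ^ₘ a) ·ᵥ x) ≡ (A ^ₘ a) ·ᵥ (A ·ᵥ x)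
·ᵥ-^ₘ-comm A a x = begin
  A ·ᵥ ((A ^ₘ a) ·ᵥ x)          ≡⟨ ·ₘ-·ᵥ-assoc A _ x ⟨
  (A ^ₘ suc a) ·ᵥ x             ≡⟨ cong (λ e → (A ^ₘ e) ·ᵥ x) (ℕP.+-comm 1 a) ⟩
  (A ^ₘ (a + 1)) ·ᵥ x           ≡⟨ ^ₘ-+-·ᵥ A a 1 x ⟩
  (A ^ₘ a) ·ᵥ ((A ^ₘ 1) ·ᵥ x)   ≡⟨ cong ((A ^ₘ a) ·ᵥ_) (trans (·ₘ-·ᵥ-assoc A idM x) (cong (A ·ᵥ_) (idM-·ᵥ x))) ⟩
  (A ^ₘ a) ·ᵥ (A ·ᵥ x)          ∎
  where open ≡-Reasoning

^ₘ-congʳ-+ : ∀ {n} (A : Matrix n n) {a b} c → A ^ₘ a ≡ A ^ₘ b → A ^ₘ (c + a) ≡ A ^ₘ (c + b)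
^ₘ-congʳ-+ A zero    eq = eq
^ₘ-congʳ-+ A (suc c) eq = cong (A ·ₘ_) (^ₘ-congʳ-+ A c eq)

^ₘ-eventually-periodic : ∀ {n} (A : Matrix n n) α β → A ^ₘ α ≡ A ^ₘ (α + β) →
                         ∀ t → A ^ₘ (α + t * β) ≡ A ^ₘ α
^ₘ-eventually-periodic A α β eq zero    = cong (A ^ₘ_) (ℕP.+-identityʳ α)
^ₘ-eventually-periodic A α β eq (suc t) = begin
  A ^ₘ (α + (β + t * β))  ≡⟨ cong (A ^ₘ_) (rearrange α β (t * β)) ⟩
  A ^ₘ (t * β + (α + β))  ≡⟨ ^ₘ-congʳ-+ A (t * β) eq ⟨
  A ^ₘ (t * β + α)        ≡⟨ cong (A ^ₘ_) (ℕP.+-comm (t * β) α) ⟩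
  A ^ₘ (α + t * β)        ≡⟨ ^ₘ-eventually-periodic A α β eq t ⟩
  A ^ₘ α                  ∎
  where
  open ≡-Reasoning
  rearrange : ∀ a b c → a + (b + c) ≡ c + (a + b)
  rearrange = ℕ-Solver.solve-∀

iterate-+ : ∀ {n} (f : Affine n) a b (u : Vector n) → iterate f (a + b) u ≡ iterate f a (iterate f b u)
iterate-+ f zero    b u = refl
iterate-+ f (suc a) b u = cong (apply f) (iterate-+ f a b u)

iterate-affine : ∀ {n} (A : Matrix n n) (b : Vector n) m (u : Vector n) →
                 iterate ⟨ A , b ⟩ m u ≡ ((A ^ₘ m) ·ᵥ u) +ᵥ iterate ⟨ A , b ⟩ m 𝟎
iterate-affine A b zero    u = sym (trans (+ᵥ-identityʳ _) (idM-·ᵥ u))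
iterate-affine {n} A b (suc m) u = begin
  (A ·ᵥ iterate ⟨ A , b ⟩ m u) +ᵥ b                    ≡⟨ cong (λ z → (A ·ᵥ z) +ᵥ b) (iterate-affine A b m u) ⟩
  (A ·ᵥ (((A ^ₘ m) ·ᵥ u) +ᵥ F)) +ᵥ b                   ≡⟨ cong (_+ᵥ b) (·ᵥ-distrib-+ᵥ A _ F) ⟩
  ((A ·ᵥ ((A ^ₘ m) ·ᵥ u)) +ᵥ (A ·ᵥ F)) +ᵥ b            ≡⟨ +ᵥ-assoc _ _ b ⟩
  (A ·ᵥ ((A ^ₘ m) ·ᵥ u)) +ᵥ ((A ·ᵥ F) +ᵥ b)            ≡⟨ cong (_+ᵥ ((A ·ᵥ F) +ᵥ b)) (·ₘ-·ᵥ-assoc A _ u) ⟨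
  ((A ·ₘ (A ^ₘ m)) ·ᵥ u) +ᵥ ((A ·ᵥ F) +ᵥ b)            ∎
  where
  open ≡-Reasoning
  F : Vector n
  F = iterate ⟨ A , b ⟩ m 𝟎

iterate-𝟎-suc : ∀ {n} (A : Matrix n n) (b : Vector n) m →
                iterate ⟨ A , b ⟩ (suc m) 𝟎 ≡ ((A ^ₘ m) ·ᵥ b) +ᵥ iterate ⟨ A , b ⟩ m 𝟎
iterate-𝟎-suc {n} A b m = begin
  iterate f (suc m) 𝟎     ≡⟨ cong (λ e → iterate f e 𝟎) (ℕP.+-comm 1 m) ⟩
  iterate f (m + 1) 𝟎     ≡⟨ iterate-+ f m 1 𝟎 ⟩
  iterate f m (apply f 𝟎) ≡⟨ cong (λ z → iterate f m (z +ᵥ b)) (·ᵥ-zeroʳ A) ⟩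
  iterate f m (𝟎 +ᵥ b)    ≡⟨ cong (iterate f m) (+ᵥ-identityˡ b) ⟩
  iterate f m b           ≡⟨ iterate-affine A b m b ⟩
  ((A ^ₘ m) ·ᵥ b) +ᵥ iterate f m 𝟎 ∎
  where
  open ≡-Reasoning
  f : Affine n
  f = ⟨ A , b ⟩

iterate-shift : ∀ {n} (A : Matrix n n) (b : Vector n) m β (u : Vector n) → A ^ₘ (m + β) ≡ A ^ₘ m →
                iterate ⟨ A , b ⟩ (m + β) u ≡ iterate ⟨ A , b ⟩ m u +ᵥ ((A ^ₘ m) ·ᵥ iterate ⟨ A , b ⟩ β 𝟎)
iterate-shift {n} A b m β u eq = begin
  iterate f (m + β) u                      ≡⟨ iterate-affine A b (m + β) u ⟩
  ((A ^ₘ (m + β)) ·ᵥ u) +ᵥ iterate f (m + β) 𝟎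
    ≡⟨ cong₂ (λ M z → (M ·ᵥ u) +ᵥ z) eq (iterate-+ f m β 𝟎) ⟩
  ((A ^ₘ m) ·ᵥ u) +ᵥ iterate f m F         ≡⟨ cong (((A ^ₘ m) ·ᵥ u) +ᵥ_) (iterate-affine A b m F) ⟩
  ((A ^ₘ m) ·ᵥ u) +ᵥ (((A ^ₘ m) ·ᵥ F) +ᵥ iterate f m 𝟎)
    ≡⟨ cong (((A ^ₘ m) ·ᵥ u) +ᵥ_) (+ᵥ-comm _ _) ⟩
  ((A ^ₘ m) ·ᵥ u) +ᵥ (iterate f m 𝟎 +ᵥ ((A ^ₘ m) ·ᵥ F))
    ≡⟨ +ᵥ-assoc _ _ _ ⟨
  (((A ^ₘ m) ·ᵥ u) +ᵥ iterate f m 𝟎) +ᵥ ((A ^ₘ m) ·ᵥ F)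
    ≡⟨ cong (_+ᵥ ((A ^ₘ m) ·ᵥ F)) (iterate-affine A b m u) ⟨
  iterate f m u +ᵥ ((A ^ₘ m) ·ᵥ F)         ∎
  where
  open ≡-Reasoning
  f : Affine n
  f = ⟨ A , b ⟩
  F : Vector n
  F = iterate f β 𝟎

-- Apply Aᵅ to the two expansions A F + b = Aᵝ b + F of f^(β+1)(0), use A^(α+β) = Aᵅ, and cancel Aᵅ b.
^ₘ-·ᵥ-iterate-fixed : ∀ {n} (A : Matrix n n) (b : Vector n) α β → A ^ₘ α ≡ A ^ₘ (α + β) →
                      A ·ᵥ ((A ^ₘ α) ·ᵥ iterate ⟨ A , b ⟩ β 𝟎) ≡ (A ^ₘ α) ·ᵥ iterate ⟨ A , b ⟩ β 𝟎
^ₘ-·ᵥ-iterate-fixed {n} A b α β eq = +ᵥ-cancelʳ _ _ (Aα ·ᵥ b) (begin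
  (A ·ᵥ (Aα ·ᵥ F)) +ᵥ (Aα ·ᵥ b)       ≡⟨ cong (_+ᵥ (Aα ·ᵥ b)) (·ᵥ-^ₘ-comm A α F) ⟩
  (Aα ·ᵥ (A ·ᵥ F)) +ᵥ (Aα ·ᵥ b)       ≡⟨ ·ᵥ-distrib-+ᵥ Aα _ _ ⟨
  Aα ·ᵥ ((A ·ᵥ F) +ᵥ b)               ≡⟨ cong (Aα ·ᵥ_) (iterate-𝟎-suc A b β) ⟩
  Aα ·ᵥ (((A ^ₘ β) ·ᵥ b) +ᵥ F)        ≡⟨ ·ᵥ-distrib-+ᵥ Aα _ _ ⟩
  (Aα ·ᵥ ((A ^ₘ β) ·ᵥ b)) +ᵥ (Aα ·ᵥ F) ≡⟨ cong (_+ᵥ (Aα ·ᵥ F)) (^ₘ-+-·ᵥ A α β b) ⟨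
  ((A ^ₘ (α + β)) ·ᵥ b) +ᵥ (Aα ·ᵥ F)  ≡⟨ cong (λ M → (M ·ᵥ b) +ᵥ (Aα ·ᵥ F)) eq ⟨
  (Aα ·ᵥ b) +ᵥ (Aα ·ᵥ F)              ≡⟨ +ᵥ-comm _ _ ⟩
  (Aα ·ᵥ F) +ᵥ (Aα ·ᵥ b)              ∎)
  where
  open ≡-Reasoning
  Aα : Matrix n n
  Aα = A ^ₘ α
  F : Vector n
  F = iterate ⟨ A , b ⟩ β 𝟎

-- Linear constraints along a ray x + t·y

slope≤0-if-bounded : ∀ c d p → (∀ t → c ℤ.+ + t ℤ.* p ℤ.≤ d) → p ℤ.≤ 0ℤ
slope≤0-if-bounded c d -[1+ _ ]  bounded = ℤ.-≤+
slope≤0-if-bounded c d (+ zero)  bounded = ℤP.≤-refl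
slope≤0-if-bounded c d (+ suc p) bounded = ⊥-elim (ℕP.n≮n N (ℤP.drop‿+≤+ (begin
  + suc N              ≡⟨ cancel c (+ suc N) ⟨
  c ℤ.+ + suc N ℤ.- c  ≤⟨ ℤP.+-monoˡ-≤ (ℤ.- c) c+t≤d ⟩
  d ℤ.- c              ≤⟨ ≤-abs (d ℤ.- c) ⟩
  + N                  ∎)))
  where
  open ℤP.≤-Reasoning
  N : ℕ
  N = ∣ d ℤ.- c ∣
  cancel : ∀ c x → (c ℤ.+ x) ℤ.- c ≡ x
  cancel = solve-∀
  ≤-abs : ∀ i → i ℤ.≤ + ∣ i ∣
  ≤-abs (+ _)    = ℤP.≤-refl
  ≤-abs -[1+ _ ] = ℤ.-≤+
  t≤t*p : + suc N ℤ.≤ + suc N ℤ.* + suc p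
  t≤t*p = subst (+ suc N ℤ.≤_) (ℤP.pos-* (suc N) (suc p)) (ℤ.+≤+ (ℕP.m≤m*n (suc N) (suc p)))
  c+t≤d : c ℤ.+ + suc N ℤ.≤ d
  c+t≤d = ℤP.≤-trans (ℤP.+-monoʳ-≤ c t≤t*p) (bounded (suc N))

bounded-if-slope≤0 : ∀ {c d p} → c ℤ.≤ d → p ℤ.≤ 0ℤ → ∀ t → c ℤ.+ + t ℤ.* p ℤ.≤ d
bounded-if-slope≤0 {c} {d} {p} c≤d p≤0 t = begin
  c ℤ.+ + t ℤ.* p  ≤⟨ ℤP.+-mono-≤ c≤d (ℤP.*-monoˡ-≤-nonNeg (+ t) p≤0) ⟩
  d ℤ.+ + t ℤ.* 0ℤ ≡⟨ cong (ℤ._+_ d) (ℤP.*-zeroʳ (+ t)) ⟩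
  d ℤ.+ 0ℤ         ≡⟨ ℤP.+-identityʳ d ⟩
  d                ∎
  where open ℤP.≤-Reasoning

lookup-·ᵥ-ray : ∀ {m n} (C : Matrix m n) (x y : Vector n) t j →
                lookup (C ·ᵥ (x +ᵥ (t *ᵥ y))) j ≡ lookup (C ·ᵥ x) j ℤ.+ + t ℤ.* lookup (C ·ᵥ y) j
lookup-·ᵥ-ray C x y t j = begin
  lookup (C ·ᵥ (x +ᵥ (t *ᵥ y))) j                 ≡⟨ cong (λ z → lookup z j) (·ᵥ-distrib-+ᵥ C x _) ⟩
  lookup ((C ·ᵥ x) +ᵥ (C ·ᵥ (t *ᵥ y))) j          ≡⟨ cong (λ z → lookup ((C ·ᵥ x) +ᵥ z) j) (·ᵥ-*ᵥ C t y) ⟩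
  lookup ((C ·ᵥ x) +ᵥ (t *ᵥ (C ·ᵥ y))) j          ≡⟨ lookup-zipWith ℤ._+_ j (C ·ᵥ x) _ ⟩
  lookup (C ·ᵥ x) j ℤ.+ lookup (t *ᵥ (C ·ᵥ y)) j  ≡⟨ cong (ℤ._+_ (lookup (C ·ᵥ x) j)) (lookup-*ᵥ t (C ·ᵥ y) j) ⟩
  lookup (C ·ᵥ x) j ℤ.+ + t ℤ.* lookup (C ·ᵥ y) j ∎
  where open ≡-Reasoning

≤ᵥ-on-ray⇒direction≤ᵥ𝟎 : ∀ {m n} (C : Matrix m n) (d : Vector m) (x y : Vector n) →
                          (∀ t → (C ·ᵥ (x +ᵥ (t *ᵥ y))) ≤ᵥ d) → (C ·ᵥ y) ≤ᵥ 𝟎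
≤ᵥ-on-ray⇒direction≤ᵥ𝟎 C d x y on-ray j =
  subst (lookup (C ·ᵥ y) j ℤ.≤_) (sym (lookup-replicate j 0ℤ))
    (slope≤0-if-bounded (lookup (C ·ᵥ x) j) (lookup d j) _
      (λ t → subst (ℤ._≤ lookup d j) (lookup-·ᵥ-ray C x y t j) (on-ray t j)))

≤ᵥ-on-ray : ∀ {m n} (C : Matrix m n) (d : Vector m) (x y : Vector n) →
            (C ·ᵥ x) ≤ᵥ d → (C ·ᵥ y) ≤ᵥ 𝟎 → ∀ t → (C ·ᵥ (x +ᵥ (t *ᵥ y))) ≤ᵥ d
≤ᵥ-on-ray C d x y origin direction t j =
  subst (ℤ._≤ lookup d j) (sym (lookup-·ᵥ-ray C x y t j))
    (bounded-if-slope≤0 (origin j) (subst (lookup (C ·ᵥ y) j ℤ.≤_) (lookup-replicate j 0ℤ) (direction j)) t)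

≤⇒∃-divMod : ∀ {a i} p .{{_ : NonZero p}} → a ≤ i → ∃[ t ] ∃[ r ] r < p × i ≡ a + r + t * p
≤⇒∃-divMod {a} {i} p a≤i = x / p , x % p , m%n<n x p , (begin
  i                     ≡⟨ ℕP.m+[n∸m]≡n a≤i ⟨
  a + x                 ≡⟨ cong (_+_ a) (m≡m%n+[m/n]*n x p) ⟩
  a + (x % p + x / p * p) ≡⟨ ℕP.+-assoc a _ _ ⟨
  a + x % p + x / p * p ∎)
  where
  open ≡-Reasoning
  x : ℕ
  x = i ∸ a

-- Running around a cycle

module _ {Q : Set} {n k : ℕ} .{{_ : NonZero k}} (δ : Fin k → Transition Q n) where
  open Cycle δ

  δℕ-cong-% : ∀ {i j} → i % k ≡ j % k → δℕ i ≡ δℕ j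
  δℕ-cong-% eq = cong δ (fromℕ<-cong _ _ eq _ _)

  δℕ-periodic : ∀ m j → δℕ (m * k + j) ≡ δℕ j
  δℕ-periodic m j = δℕ-cong-% (trans (cong (_% k) (ℕP.+-comm (m * k) j)) ([m+kn]%n≡m%n j m k))

  δℕ-toℕ : ∀ f → δℕ (toℕ f) ≡ δ f
  δℕ-toℕ f = cong δ (toℕ-injective (trans (toℕ-fromℕ< _) (m<n⇒m%n≡m (toℕ<n f))))

  -- The translation part of f_{i-1} ∘ ⋯ ∘ f_0: b_c in Horner form.
  offset : ℕ → Vector n
  offset zero    = 𝟎
  offset (suc i) = (Aℕ i ·ᵥ offset i) +ᵥ bℕ i

  prodFrom-suc : ∀ i m (x : Vector n) → prodFrom i (suc m) ·ᵥ x ≡ prodFrom (suc i) m ·ᵥ (Aℕ i ·ᵥ x)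
  prodFrom-suc i zero x = begin
    (Aℕ (i + 0) ·ₘ idM) ·ᵥ x  ≡⟨ ·ₘ-·ᵥ-assoc _ idM x ⟩
    Aℕ (i + 0) ·ᵥ (idM ·ᵥ x)  ≡⟨ cong₂ _·ᵥ_ (cong Aℕ (ℕP.+-identityʳ i)) (idM-·ᵥ x) ⟩
    Aℕ i ·ᵥ x                 ≡⟨ idM-·ᵥ _ ⟨
    idM ·ᵥ (Aℕ i ·ᵥ x)        ∎
    where open ≡-Reasoning
  prodFrom-suc i (suc m) x = begin
    (Aℕ (i + suc m) ·ₘ prodFrom i (suc m)) ·ᵥ x            ≡⟨ ·ₘ-·ᵥ-assoc _ _ x ⟩
    Aℕ (i + suc m) ·ᵥ (prodFrom i (suc m) ·ᵥ x)
      ≡⟨ cong₂ _·ᵥ_ (cong Aℕ (ℕP.+-suc i m)) (prodFrom-suc i m x) ⟩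
    Aℕ (suc i + m) ·ᵥ (prodFrom (suc i) m ·ᵥ (Aℕ i ·ᵥ x))  ≡⟨ ·ₘ-·ᵥ-assoc _ _ _ ⟨
    (Aℕ (suc i + m) ·ₘ prodFrom (suc i) m) ·ᵥ (Aℕ i ·ᵥ x)  ∎
    where open ≡-Reasoning

  bsum≡prodFrom-·ᵥ-offset : ∀ i → i ≤ k → bsum i ≡ prodFrom i (k ∸ i) ·ᵥ offset i
  bsum≡prodFrom-·ᵥ-offset zero    _   = sym (·ᵥ-zeroʳ _)
  bsum≡prodFrom-·ᵥ-offset (suc i) i<k = begin
    bsum i +ᵥ (P ·ᵥ bℕ i)
      ≡⟨ cong (_+ᵥ (P ·ᵥ bℕ i)) (bsum≡prodFrom-·ᵥ-offset i (ℕP.<⇒≤ i<k)) ⟩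
    (prodFrom i (k ∸ i) ·ᵥ offset i) +ᵥ (P ·ᵥ bℕ i)
      ≡⟨ cong (λ e → (prodFrom i e ·ᵥ offset i) +ᵥ (P ·ᵥ bℕ i)) (ℕP.+-∸-assoc 1 i<k) ⟩
    (prodFrom i (suc (k ∸ suc i)) ·ᵥ offset i) +ᵥ (P ·ᵥ bℕ i)
      ≡⟨ cong (_+ᵥ (P ·ᵥ bℕ i)) (prodFrom-suc i _ (offset i)) ⟩
    (P ·ᵥ (Aℕ i ·ᵥ offset i)) +ᵥ (P ·ᵥ bℕ i)
      ≡⟨ ·ᵥ-distrib-+ᵥ P _ _ ⟨
    P ·ᵥ offset (suc i) ∎
    where
    open ≡-Reasoning
    P : Matrix n n
    P = prodFrom (suc i) (k ∸ suc i)

  bc≡offset : bc ≡ offset k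
  bc≡offset = begin
    bsum k                         ≡⟨ bsum≡prodFrom-·ᵥ-offset k ℕP.≤-refl ⟩
    prodFrom k (k ∸ k) ·ᵥ offset k ≡⟨ cong (λ e → prodFrom k e ·ᵥ offset k) (ℕP.n∸n≡0 k) ⟩
    idM ·ᵥ offset k                ≡⟨ idM-·ᵥ _ ⟩
    offset k                       ∎
    where open ≡-Reasoning

  module _ (v : ℕ → Vector n) (step : ∀ j → v (suc j) ≡ (Aℕ j ·ᵥ v j) +ᵥ bℕ j) where

    step-after-turns : ∀ m j → v (m * k + suc j) ≡ (Aℕ j ·ᵥ v (m * k + j)) +ᵥ bℕ j
    step-after-turns m j = trans (cong v (ℕP.+-suc (m * k) j))
      (trans (step _) (cong (λ T → (Transition.A T ·ᵥ v (m * k + j)) +ᵥ Transition.b T) (δℕ-periodic m j)))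

    run-within-turn : ∀ m i → v (m * k + i) ≡ (prodFrom 0 i ·ᵥ v (m * k)) +ᵥ offset i
    run-within-turn m zero    = trans (cong v (ℕP.+-identityʳ _)) (sym (trans (+ᵥ-identityʳ _) (idM-·ᵥ _)))
    run-within-turn m (suc i) = begin
      v (m * k + suc i)
        ≡⟨ step-after-turns m i ⟩
      (Aℕ i ·ᵥ v (m * k + i)) +ᵥ bℕ i
        ≡⟨ cong (λ z → (Aℕ i ·ᵥ z) +ᵥ bℕ i) (run-within-turn m i) ⟩
      (Aℕ i ·ᵥ ((prodFrom 0 i ·ᵥ u) +ᵥ offset i)) +ᵥ bℕ i
        ≡⟨ cong (_+ᵥ bℕ i) (·ᵥ-distrib-+ᵥ (Aℕ i) _ _) ⟩
      ((Aℕ i ·ᵥ (prodFrom 0 i ·ᵥ u)) +ᵥ (Aℕ i ·ᵥ offset i)) +ᵥ bℕ i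
        ≡⟨ +ᵥ-assoc _ _ _ ⟩
      (Aℕ i ·ᵥ (prodFrom 0 i ·ᵥ u)) +ᵥ offset (suc i)
        ≡⟨ cong (_+ᵥ offset (suc i)) (·ₘ-·ᵥ-assoc _ _ _) ⟨
      (prodFrom 0 (suc i) ·ᵥ u) +ᵥ offset (suc i)
        ∎
      where
      open ≡-Reasoning
      u : Vector n
      u = v (m * k)

    run-turns : ∀ m → v (m * k) ≡ iterate fc m (v 0)
    run-turns zero    = refl
    run-turns (suc m) = begin
      v (k + m * k)               ≡⟨ cong v (ℕP.+-comm k (m * k)) ⟩
      v (m * k + k)               ≡⟨ run-within-turn m k ⟩
      (Ac ·ᵥ v (m * k)) +ᵥ offset k ≡⟨ cong₂ (λ x y → (Ac ·ᵥ x) +ᵥ y) (run-turns m) (sym bc≡offset) ⟩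
      apply fc (iterate fc m (v 0)) ∎
      where open ≡-Reasoning

  w≡prodFrom-·ᵥ-w₀ : ∀ α β j → w α β j ≡ prodFrom 0 j ·ᵥ w α β 0
  w≡prodFrom-·ᵥ-w₀ α β zero    = sym (idM-·ᵥ _)
  w≡prodFrom-·ᵥ-w₀ α β (suc j) = trans (cong (Aℕ j ·ᵥ_) (w≡prodFrom-·ᵥ-w₀ α β j)) (sym (·ₘ-·ᵥ-assoc _ _ _))

  module _ (α β : ℕ) (Acᵅ≡Acᵅ⁺ᵝ : Ac ^ₘ α ≡ Ac ^ₘ (α + β)) where

    w-+k : ∀ j → w α β (k + j) ≡ w α β j
    w-+k zero    = begin
      w α β (k + 0)        ≡⟨ cong (w α β) (ℕP.+-identityʳ k) ⟩
      w α β k              ≡⟨ w≡prodFrom-·ᵥ-w₀ α β k ⟩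
      Ac ·ᵥ w α β 0        ≡⟨ ^ₘ-·ᵥ-iterate-fixed Ac bc α β Acᵅ≡Acᵅ⁺ᵝ ⟩
      w α β 0              ∎
      where open ≡-Reasoning
    w-+k (suc j) = trans (cong (w α β) (ℕP.+-suc k j))
      (cong₂ _·ᵥ_ (cong Transition.A (δℕ-cong-% (trans (cong (_% k) (ℕP.+-comm k j)) ([m+n]%n≡m%n j k))))
                  (w-+k j))

    w-periodic : ∀ m j → w α β (m * k + j) ≡ w α β j
    w-periodic zero    j = refl
    w-periodic (suc m) j = trans (cong (w α β) (ℕP.+-assoc k (m * k) j)) (trans (w-+k _) (w-periodic m j))

    iterable-at : InfinitelyIterable α β → ∀ j → (Transition.C (δℕ j) ·ᵥ w α β j) ≤ᵥ 𝟎
    iterable-at iterable j =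
      subst (λ x → (Transition.C (δℕ j) ·ᵥ x) ≤ᵥ 𝟎) (sym w-j≡w-j%k) (iterable (j mod k))
      where
      w-j≡w-j%k : w α β j ≡ w α β (toℕ (j mod k))
      w-j≡w-j%k = begin
        w α β j                   ≡⟨ cong (w α β) (trans (m≡m%n+[m/n]*n j k) (ℕP.+-comm (j % k) _)) ⟩
        w α β (j / k * k + j % k) ≡⟨ w-periodic (j / k) (j % k) ⟩
        w α β (j % k)             ≡⟨ cong (w α β) (toℕ-fromℕ< (m%n<n j k)) ⟨
        w α β (toℕ (j mod k))     ∎
        where open ≡-Reasoning

    module _ (v : ℕ → Vector n) (step : ∀ j → v (suc j) ≡ (Aℕ j ·ᵥ v j) +ᵥ bℕ j) where

      shift-β-turns : ∀ m → Ac ^ₘ m ≡ Ac ^ₘ α → Ac ^ₘ (m + β) ≡ Ac ^ₘ α →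
                      ∀ j → v ((m + β) * k + j) ≡ v (m * k + j) +ᵥ w α β j
      shift-β-turns m Acᵐ≡Acᵅ Acᵐ⁺ᵝ≡Acᵅ zero = begin
        v ((m + β) * k + 0)
          ≡⟨ cong v (ℕP.+-identityʳ _) ⟩
        v ((m + β) * k)
          ≡⟨ run-turns v step (m + β) ⟩
        iterate fc (m + β) (v 0)
          ≡⟨ iterate-shift Ac bc m β (v 0) (trans Acᵐ⁺ᵝ≡Acᵅ (sym Acᵐ≡Acᵅ)) ⟩
        iterate fc m (v 0) +ᵥ ((Ac ^ₘ m) ·ᵥ iterate fc β 𝟎)
          ≡⟨ cong₂ (λ x M → x +ᵥ (M ·ᵥ iterate fc β 𝟎)) (sym (run-turns v step m)) Acᵐ≡Acᵅ ⟩
        v (m * k) +ᵥ w α β 0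
          ≡⟨ cong (λ i → v i +ᵥ w α β 0) (ℕP.+-identityʳ _) ⟨
        v (m * k + 0) +ᵥ w α β 0
          ∎
        where open ≡-Reasoning
      shift-β-turns m Acᵐ≡Acᵅ Acᵐ⁺ᵝ≡Acᵅ (suc j) = begin
        v ((m + β) * k + suc j)
          ≡⟨ step-after-turns v step (m + β) j ⟩
        (Aℕ j ·ᵥ v ((m + β) * k + j)) +ᵥ bℕ j
          ≡⟨ cong (λ x → (Aℕ j ·ᵥ x) +ᵥ bℕ j) (shift-β-turns m Acᵐ≡Acᵅ Acᵐ⁺ᵝ≡Acᵅ j) ⟩
        (Aℕ j ·ᵥ (v (m * k + j) +ᵥ w α β j)) +ᵥ bℕ j
          ≡⟨ cong (_+ᵥ bℕ j) (·ᵥ-distrib-+ᵥ (Aℕ j) _ _) ⟩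
        ((Aℕ j ·ᵥ v (m * k + j)) +ᵥ w α β (suc j)) +ᵥ bℕ j
          ≡⟨ swap _ _ _ ⟩
        ((Aℕ j ·ᵥ v (m * k + j)) +ᵥ bℕ j) +ᵥ w α β (suc j)
          ≡⟨ cong (_+ᵥ w α β (suc j)) (step-after-turns v step m j) ⟨
        v (m * k + suc j) +ᵥ w α β (suc j)
          ∎
        where
        open ≡-Reasoning
        swap : ∀ x y z → (x +ᵥ y) +ᵥ z ≡ (x +ᵥ z) +ᵥ y
        swap x y z = trans (+ᵥ-assoc x y z) (trans (cong (x +ᵥ_) (+ᵥ-comm y z)) (sym (+ᵥ-assoc x z y)))

      on-ray : ∀ t j → v ((α + t * β) * k + j) ≡ v (α * k + j) +ᵥ (t *ᵥ w α β j)
      on-ray zero    j = trans (cong (λ e → v (e * k + j)) (ℕP.+-identityʳ α)) (sym (+ᵥ-identityʳ _))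
      on-ray (suc t) j = begin
        v ((α + (β + t * β)) * k + j)                   ≡⟨ cong (λ e → v (e * k + j)) (rearrange α β (t * β)) ⟩
        v ((α + t * β + β) * k + j)                     ≡⟨ shift-β-turns (α + t * β) (powers t) Acᵐ⁺ᵝ≡Acᵅ j ⟩
        v ((α + t * β) * k + j) +ᵥ w α β j              ≡⟨ cong (_+ᵥ w α β j) (on-ray t j) ⟩
        (v (α * k + j) +ᵥ (t *ᵥ w α β j)) +ᵥ w α β j    ≡⟨ +ᵥ-assoc _ _ _ ⟩
        v (α * k + j) +ᵥ (suc t *ᵥ w α β j)             ∎
        where
        open ≡-Reasoning
        rearrange : ∀ a b c → a + (b + c) ≡ a + c + b
        rearrange = ℕ-Solver.solve-∀
        powers : ∀ t → Ac ^ₘ (α + t * β) ≡ Ac ^ₘ α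
        powers = ^ₘ-eventually-periodic Ac α β Acᵅ≡Acᵅ⁺ᵝ
        Acᵐ⁺ᵝ≡Acᵅ : Ac ^ₘ (α + t * β + β) ≡ Ac ^ₘ α
        Acᵐ⁺ᵝ≡Acᵅ = trans (cong (Ac ^ₘ_) (sym (rearrange α β (t * β)))) (powers (suc t))

      Guarded : ℕ → Set
      Guarded i = Transition.Sat (δℕ i) (v i)

      guarded-on-ray⇔ : ∀ t j →
        Guarded ((α + t * β) * k + j) ⇔ Transition.Sat (δℕ j) (v (α * k + j) +ᵥ (t *ᵥ w α β j))
      guarded-on-ray⇔ t j = mk⇔ (subst₂ Transition.Sat (δℕ-periodic (α + t * β) j) (on-ray t j))
                                (subst₂ Transition.Sat (sym (δℕ-periodic (α + t * β) j)) (sym (on-ray t j)))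

      iterable-if-guarded : (∀ i → Guarded i) → InfinitelyIterable α β
      iterable-if-guarded guarded f = subst (λ T → (Transition.C T ·ᵥ w α β (toℕ f)) ≤ᵥ 𝟎) (δℕ-toℕ f)
        (≤ᵥ-on-ray⇒direction≤ᵥ𝟎 (Transition.C (δℕ j)) (Transition.d (δℕ j)) (v (α * k + j)) (w α β j)
          (λ t → Equivalence.to (guarded-on-ray⇔ t j) (guarded _)))
        where
        j : ℕ
        j = toℕ f

      guarded-beyond : .{{_ : NonZero β}} → InfinitelyIterable α β → (∀ i → i < (α + β) * k → Guarded i) →
                       ∀ i → α * k ≤ i → Guarded i
      guarded-beyond iterable early i αk≤i with ≤⇒∃-divMod (β * k) {{ℕP.m*n≢0 β k}} αk≤i
      ... | t , j , j<βk , i≡ = subst Guarded (sym (trans i≡ (rearrange α β k j t)))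
        (Equivalence.from (guarded-on-ray⇔ t j)
          (≤ᵥ-on-ray (Transition.C (δℕ j)) (Transition.d (δℕ j)) (v (α * k + j)) (w α β j)
                     origin (iterable-at iterable j) t))
        where
        rearrange : ∀ a b k j t → a * k + j + t * (b * k) ≡ (a + t * b) * k + j
        rearrange = ℕ-Solver.solve-∀
        αk+j<[α+β]k : α * k + j < (α + β) * k
        αk+j<[α+β]k = subst (α * k + j <_) (sym (ℕP.*-distribʳ-+ k α β)) (ℕP.+-monoʳ-< (α * k) j<βk)
        origin : Transition.Sat (δℕ j) (v (α * k + j))
        origin = subst (λ T → Transition.Sat T (v (α * k + j))) (δℕ-periodic α j) (early _ αk+j<[α+β]k)

      guarded-if-iterable : .{{_ : NonZero β}} → InfinitelyIterable α β →
                            (∀ i → i < (α + β) * k → Guarded i) → ∀ i → Guarded i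
      guarded-if-iterable iterable early i with i ℕP.<? (α + β) * k
      ... | yes i<B = early i i<B
      ... | no  i≮B = guarded-beyond iterable early i
                        (ℕP.≤-trans (ℕP.*-monoˡ-≤ k (ℕP.m≤m+n α β)) (ℕP.≮⇒≥ i≮B))

lemma5 : ∀ {n} (S : ACS n) (k : ℕ) .{{_ : NonZero k}}
           (δ : Fin k → Transition (ACS.Q S) n) → SimpleCycle S k δ →
           (α β : ℕ) → 1 ≤ β →
           Cycle.Ac δ ^ₘ α ≡ Cycle.Ac δ ^ₘ (α + β) →
           (q : ℕ → ACS.Q S) (v : ℕ → Vector n) (τ : ℕ → Transition (ACS.Q S) n) →
           IsPseudoExecution S q v τ →
           (∀ i → τ i ≡ δ (i mod k)) →
           (IsExecution S q v τ
             ⇔ (Cycle.InfinitelyIterable δ α β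
                × (∀ i → i < (α + β + 1) * k → Transition.Sat (τ i) (v i))))
lemma5 S k δ _ α β 1≤β Acᵅ≡Acᵅ⁺ᵝ q v τ pseudo τ≡δ = mk⇔
  (λ exec → iterable-if-guarded δ α β Acᵅ≡Acᵅ⁺ᵝ v step (λ i → to-δ i (guard exec i)) , λ i _ → guard exec i)
  (λ (iterable , early) i → proj₁ (pseudo i) , proj₂ (pseudo i) , from-δ i
     (guarded-if-iterable δ α β Acᵅ≡Acᵅ⁺ᵝ v step {{>-nonZero 1≤β}} iterable
       (λ j j<[α+β]k → to-δ j (early j (ℕP.<-≤-trans j<[α+β]k (ℕP.*-monoˡ-≤ k (ℕP.m≤m+n (α + β) 1))))) i))
  where
  open Cycle δ using (δℕ; Aℕ; bℕ)
  step : ∀ j → v (suc j) ≡ (Aℕ j ·ᵥ v j) +ᵥ bℕ j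
  step j = subst (λ T → v (suc j) ≡ apply (Transition.update T) (v j)) (τ≡δ j) (proj₂ (proj₂ (proj₂ (pseudo j))))
  guard : IsExecution S q v τ → ∀ i → Transition.Sat (τ i) (v i)
  guard exec i = proj₂ (proj₂ (exec i))
  to-δ : ∀ i → Transition.Sat (τ i) (v i) → Transition.Sat (δℕ i) (v i)
  to-δ i = subst (λ T → Transition.Sat T (v i)) (τ≡δ i)
  from-δ : ∀ i → Transition.Sat (δℕ i) (v i) → Transition.Sat (τ i) (v i)
  from-δ i = subst (λ T → Transition.Sat T (v i)) (sym (τ≡δ i))
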